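{- Let $q\ge3$ be a prime power, $k\ge2$, and let $D\subseteq\mathbb{F}_q^k\setminus\{0\}$ be a vectorial cutting blocking set with $aD=D$ for every $a\in\mathbb{F}_q^*$; put $n=\#D$ and $\widetilde{[D,D]}=\{(x,1):x\in D\}\cup\{(x,0):x\in D\}\subseteq\mathbb{F}_q^{k+1}$. Let $A_i$ be the number of codewords of weight $i$ in $\mathrm{C}_D$ and $B_i$ the number of codewords of weight $i$ in $\mathrm{C}_{\widetilde{[D,D]}}$. Then the weight spectrum of $\mathrm{C}_{\widetilde{[D,D]}}$ is $$\bigcup_{i=0}^{n}\Bigl\{2i,\ n+\tfrac{q-2}{q-1}i\ :\ A_i\neq0\Bigr\}$$ (excluding the weight $0$), and $$B_i=\eta_{i/2}A_{i/2}+(q-1)\,\eta_{(i-n)\frac{q-1}{q-2}}A_{(i-n)\frac{q-1}{q-2}},$$ where $\eta_s=1$ if $s\in\mathbb{Z}$ and $\eta_s=0$ otherwise (and $A_t=0$ for $t$ outside $\{0,\dots,n\}$).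
   Context: For a finite list $D$ of points of $\mathbb{F}_q^m$, $\mathrm{C}_D=\{(a\cdot P)_{P\in D}:a\in\mathbb{F}_q^m\}$; weights are Hamming weights. A set $M\subseteq\mathbb{F}_q^k$ is a vectorial cutting blocking set if for every $(k-1)$-dimensional linear subspace $H$ of $\mathbb{F}_q^k$, the span of $M\cap H$ equals $H$. -}

module Defs where

open import Level using (0ℓ)
open import Data.Nat as ℕ using (ℕ; zero; suc)
open import Data.Nat.Divisibility using (_∣_; _∣?_; divides)
open import Data.Nat.Primality using (Prime)
open import Data.Product using (Σ; ∃; _×_; _,_)
open import Data.List using (List; []; _∷_; [_]; map; filter; length; concatMap; deduplicate; _++_)
import Data.List.Properties as LP
open import Data.List.Membership.Propositional using (_∈_)
open import Data.List.Relation.Unary.Unique.Propositional using (Unique)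
open import Data.Vec using (Vec; []; _∷_; _∷ʳ_; replicate; zipWith; foldr)
import Data.Vec.Properties as VP
open import Relation.Binary.PropositionalEquality using (_≡_; _≢_)
open import Relation.Binary.Definitions using (DecidableEquality)
open import Relation.Nullary using (¬?; yes; no)
open import Relation.Nullary.Decidable using (_×-dec_)
open import Algebra.Structures using (IsCommutativeRing)
open import Function.Bundles using (_⇔_)

IsPrimePower : ℕ → Set
IsPrimePower q = Σ ℕ λ p → Σ ℕ λ e → Prime p × q ≡ p ℕ.^ suc e

record FiniteField (q : ℕ) : Set₁ where
  infixl 7 _*_
  infixl 6 _+_
  field
    F     : Set
    _+_   : F → F → F
    _*_   : F → F → F
    -_    : F → F
    0#    : F
    1#    : F
    isCommutativeRing : IsCommutativeRing _≡_ _+_ _*_ -_ 0# 1#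
    0≢1   : 0# ≢ 1#
    inverse : ∀ x → x ≢ 0# → Σ F λ y → x * y ≡ 1#
    _≟_   : DecidableEquality F
    elements : List F
    complete : ∀ x → x ∈ elements
    unique   : Unique elements
    card     : length elements ≡ q

module FF {q : ℕ} (𝔽 : FiniteField q) where
  open FiniteField 𝔽

  0v : ∀ {m} → Vec F m
  0v = replicate _ 0#

  _·_ : ∀ {m} → Vec F m → Vec F m → F
  a · x = foldr _ _+_ 0# (zipWith _*_ a x)

  scale : ∀ {m} → F → Vec F m → Vec F m
  scale c x = Data.Vec.map (c *_) x

  _+v_ : ∀ {m} → Vec F m → Vec F m → Vec F m
  _+v_ = zipWith _+_

  allVecs : (m : ℕ) → List (Vec F m)
  allVecs zero = [ [] ]
  allVecs (suc m) = concatMap (λ c → map (c ∷_) (allVecs m)) elements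

  data Span {m : ℕ} (S : Vec F m → Set) : Vec F m → Set where
    span-0 : Span S 0v
    span-+ : ∀ (c : F) (y x : Vec F m) → S y → Span S x → Span S (scale c y +v x)

  -- the (k-1)-dimensional linear subspaces of F_q^k are exactly the kernels
  -- {x : u · x = 0} of nonzero vectors u
  Hyperplane : ∀ {k} → Vec F k → Vec F k → Set
  Hyperplane u x = u · x ≡ 0#

  VectorialCutting : ∀ {k} → List (Vec F k) → Set
  VectorialCutting {k} M =
    ∀ (u : Vec F k) → u ≢ 0v → ∀ (x : Vec F k) →
      Span (λ y → y ∈ M × Hyperplane u y) x ⇔ Hyperplane u x

  codeword : ∀ {m} → List (Vec F m) → Vec F m → List F
  codeword D a = map (a ·_) D

  code : ∀ {m} → List (Vec F m) → List (List F)
  code {m} D = deduplicate (LP.≡-dec _≟_) (map (codeword D) (allVecs m))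

  weight : List F → ℕ
  weight c = length (filter (λ x → ¬? (x ≟ 0#)) c)

  numWeight : ∀ {m} → List (Vec F m) → ℕ → ℕ
  numWeight D i = length (filter (λ c → weight c ℕ.≟ i) (code D))

  doubleD : ∀ {k} → List (Vec F k) → List (Vec F (suc k))
  doubleD D = map (λ x → x ∷ʳ 1#) D ++ map (λ x → x ∷ʳ 0#) D

-- η_{num/den} A_{num/den}: equals A t if num = t * den for a natural t, else 0
etaA : (ℕ → ℕ) → (num den : ℕ) → ℕ
etaA A num den with den ∣? num
... | yes (divides t _) = A t
... | no _ = 0

-- η_s A_s for s = (i - n)(q-1)/(q-2); A_s = 0 when s is negative (i < n)
secondTerm : (ℕ → ℕ) → (q n i : ℕ) → ℕ
secondTerm A q n i with n ℕ.≤? i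
... | yes _ = etaA A ((i ℕ.∸ n) ℕ.* (q ℕ.∸ 1)) (q ℕ.∸ 2)
... | no _ = 0

-- Every vector lies on some hyperplane H, and H is spanned by D ∩ H, so a vectorial cutting
-- blocking set D spans F_q^k; hence a ↦ (a · x)_{x ∈ D} is injective, and A_t counts the
-- vectors a with wt(a) = t. Since D is stable under F_q^*, the fibres {x ∈ D : a · x = c}
-- with c ≠ 0 all have the same size m_a, so wt(a) = (q − 1) m_a. The codeword of (a, b) in
-- C_[D,D]~ has weight 2 wt(a) if b = 0 and (n − m_a) + wt(a) = n + (q − 2) m_a if b ≠ 0.
-- Summing over b gives B_i = #{a : 2 wt(a) = i} + (q − 1) #{a : n + (q − 2) m_a = i}; expressing
-- both conditions through wt(a) yields the formula, and the spectrum is read off from it.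

module Submission where

open import Defs
open import Level using (Level; 0ℓ)
open import Data.Nat using (ℕ; zero; suc; _∸_; _≤_; s≤s; NonZero)
import Data.Nat as ℕ
import Data.Nat.Properties as ℕ
open import Data.Product using (Σ; ∃; _×_; _,_; swap)
open import Data.Sum using (_⊎_; inj₁; inj₂)
open import Data.Empty using (⊥-elim)
open import Data.List using (List; []; _∷_; [_]; _++_; map; filter; length; concatMap; cartesianProductWith)
import Data.List.Properties as List
open import Data.List.Membership.Propositional using (_∈_)
open import Data.List.Membership.Propositional.Properties
  using (∈-filter⁻; ∈-map⁺; ∈-map⁻; ∈-++⁺ˡ; ∈-++⁺ʳ; ∈-cartesianProductWith⁺; deduplicate-∈⇔)
open import Data.List.Relation.Unary.Any using (here; there)
open import Data.List.Relation.Unary.All as All using (All; []; _∷_)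
open import Data.List.Relation.Unary.AllPairs using ([]; _∷_)
open import Data.List.Relation.Unary.Unique.Propositional using (Unique)
import Data.List.Relation.Unary.Unique.Propositional.Properties as Unique
open import Data.List.Relation.Unary.Unique.DecPropositional.Properties using (deduplicate-!)
open import Data.List.Relation.Binary.Permutation.Propositional using (_↭_)
open import Data.Vec using (Vec; []; _∷_; _∷ʳ_; initLast)
import Data.Vec.Properties as Vec
open import Algebra.Bundles using (CommutativeRing)
open import Relation.Binary.PropositionalEquality using (_≡_; _≢_; refl; sym; trans; cong; cong₂; subst; subst₂; module ≡-Reasoning)
open import Relation.Binary.Definitions using (DecidableEquality)
open import Relation.Nullary using (¬_; ¬?; yes; no; contradiction)
open import Relation.Unary using (Pred; Decidable; _≐_)
open import Function.Bundles using (_⇔_; mk⇔; Equivalence)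

module Counting where

  open import Data.Nat using (_+_; _*_)
  open import Data.Nat.ListAction using (sum)
  open import Data.List.Properties using (filter-++; length-++; filter-≐; filter-accept; filter-reject; filter-none; map-cong)
  open import Data.List.Relation.Binary.Permutation.Propositional.Properties using (↭-length; filter-↭)
  open import Data.List.Relation.Binary.BagAndSetEquality using (∼bag⇒↭)
  open import Data.List.Membership.Propositional.Properties.WithK using (unique∧set⇒bag)
  open import Algebra.Properties.CommutativeSemigroup ℕ.+-commutativeSemigroup using (x∙yz≈y∙xz; interchange)

  private
    variable
      a b c p q : Level
      A : Set a
      B : Set b
      C : Set c
      xs ys : List A

  count : {P : Pred A p} → Decidable P → List A → ℕ
  count P? xs = length (filter P? xs)

  ∑ : List A → (A → ℕ) → ℕ
  ∑ xs f = sum (map f xs)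

  syntax ∑ xs (λ x → e) = ∑[ x ∈ xs ] e

  module _ {P : Pred A p} (P? : Decidable P) where

    count-++ : ∀ xs ys → count P? (xs ++ ys) ≡ count P? xs + count P? ys
    count-++ xs ys = trans (cong length (filter-++ P? xs ys)) (length-++ (filter P? xs))

    count-+-count-∁ : ∀ xs → count P? xs + count (λ x → ¬? (P? x)) xs ≡ length xs
    count-+-count-∁ [] = refl
    count-+-count-∁ (x ∷ xs) with P? x
    ... | yes _ = cong suc (count-+-count-∁ xs)
    ... | no _  = trans (ℕ.+-suc _ _) (cong suc (count-+-count-∁ xs))

    count-↭ : xs ↭ ys → count P? xs ≡ count P? ys
    count-↭ xs↭ys = ↭-length (filter-↭ P? xs↭ys)

    count-none : (∀ x → ¬ P x) → ∀ xs → count P? xs ≡ 0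
    count-none ¬P xs = cong length (filter-none P? {xs} (All.tabulate λ {x} _ → ¬P x))

    count≢0⇒∃ : ∀ xs → count P? xs ≢ 0 → ∃ λ x → x ∈ xs × P x
    count≢0⇒∃ xs count≢0 with filter P? xs in eq
    ... | []    = ⊥-elim (count≢0 refl)
    ... | y ∷ _ = y , ∈-filter⁻ P? (subst (y ∈_) (sym eq) (here refl))

  module _ {P : Pred A p} {Q : Pred A q} (P? : Decidable P) (Q? : Decidable Q) where

    count-≐ : P ≐ Q → ∀ xs → count P? xs ≡ count Q? xs
    count-≐ P≐Q xs = cong length (filter-≐ P? Q? P≐Q xs)

  module _ {P : Pred B p} (P? : Decidable P) (f : A → B) where

    count-map : ∀ xs → count P? (map f xs) ≡ count (λ x → P? (f x)) xs
    count-map [] = refl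
    count-map (x ∷ xs) with P? (f x)
    ... | yes _ = cong suc (count-map xs)
    ... | no _  = count-map xs

  count-cartesianProductWith : {P : Pred C p} (P? : Decidable P) (f : A → B → C) → ∀ xs ys →
    count P? (cartesianProductWith f xs ys) ≡ ∑[ x ∈ xs ] count (λ y → P? (f x y)) ys
  count-cartesianProductWith P? f [] ys = refl
  count-cartesianProductWith P? f (x ∷ xs) ys = trans (count-++ P? (map (f x) ys) _)
    (cong₂ _+_ (count-map P? (f x) ys) (count-cartesianProductWith P? f xs ys))

  ∑-cong : {f g : A → ℕ} → (∀ x → f x ≡ g x) → ∀ xs → ∑ xs f ≡ ∑ xs g
  ∑-cong f≗g xs = cong sum (map-cong f≗g xs)

  ∑-+ : (f g : A → ℕ) → ∀ xs → ∑[ x ∈ xs ] (f x + g x) ≡ ∑ xs f + ∑ xs g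
  ∑-+ f g [] = refl
  ∑-+ f g (x ∷ xs) = trans (cong (f x + g x +_) (∑-+ f g xs)) (interchange (f x) (g x) _ _)

  ∑-const : {f : A → ℕ} {μ : ℕ} → All (λ x → f x ≡ μ) xs → ∑ xs f ≡ length xs * μ
  ∑-const [] = refl
  ∑-const (fx≡μ ∷ f≡μ) = cong₂ _+_ fx≡μ (∑-const f≡μ)

  ∑-const-except : {f : A → ℕ} {μ : ℕ} {z : A} → Unique xs → z ∈ xs → (∀ x → x ≢ z → f x ≡ μ) →
    ∑ xs f ≡ f z + (length xs ∸ 1) * μ
  ∑-const-except (z∉ys ∷ _) (here refl) f≡μ =
    cong (_ +_) (∑-const (All.map (λ z≢x → f≡μ _ (λ x≡z → z≢x (sym x≡z))) z∉ys))
  ∑-const-except {xs = x ∷ ys@(_ ∷ _)} {f = f} {μ} {z} (x∉ys ∷ u) (there z∈ys) f≡μ = begin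
    f x + ∑ ys f                          ≡⟨ cong₂ _+_ (f≡μ x (All.lookup x∉ys z∈ys)) (∑-const-except u z∈ys f≡μ) ⟩
    μ + (f z + (length ys ∸ 1) * μ)       ≡⟨ x∙yz≈y∙xz μ (f z) _ ⟩
    f z + (length ys * μ)                 ∎
    where open ≡-Reasoning

  module _ (_≟_ : DecidableEquality B) {E : List B} (E-unique : Unique E) (E-complete : ∀ c → c ∈ E) where

    ∑-count-fibres : (f : A → B) → ∀ xs → ∑[ c ∈ E ] count (λ x → f x ≟ c) xs ≡ length xs
    ∑-count-fibres f [] = trans (∑-const {xs = E} {f = λ _ → 0} (All.tabulate (λ _ → refl))) (ℕ.*-zeroʳ (length E))
    ∑-count-fibres f (x ∷ xs) = begin
      ∑[ c ∈ E ] count (λ y → f y ≟ c) (x ∷ xs)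
        ≡⟨ ∑-cong (λ c → count-++ (λ y → f y ≟ c) [ x ] xs) E ⟩
      ∑[ c ∈ E ] (count (λ y → f y ≟ c) [ x ] + count (λ y → f y ≟ c) xs)
        ≡⟨ ∑-+ _ _ E ⟩
      ∑[ c ∈ E ] count (λ y → f y ≟ c) [ x ] + ∑[ c ∈ E ] count (λ y → f y ≟ c) xs
        ≡⟨ cong₂ _+_ hits-once (∑-count-fibres f xs) ⟩
      suc (length xs)
        ∎
      where
      open ≡-Reasoning
      misses : ∀ c → c ≢ f x → count (λ y → f y ≟ c) [ x ] ≡ 0
      misses c c≢fx = cong length (filter-reject (λ y → f y ≟ c) (λ fx≡c → c≢fx (sym fx≡c)))
      hits-once : ∑[ c ∈ E ] count (λ y → f y ≟ c) [ x ] ≡ 1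
      hits-once = trans (∑-const-except E-unique (E-complete (f x)) misses)
        (cong₂ _+_ (cong length (filter-accept (λ y → f y ≟ f x) refl)) (ℕ.*-zeroʳ (length E ∸ 1)))

  map-≡⇒≡ : (f g : A → B) → map f xs ≡ map g xs → ∀ {x} → x ∈ xs → f x ≡ g x
  map-≡⇒≡ {xs = _ ∷ _} f g eq (here refl) = List.∷-injectiveˡ eq
  map-≡⇒≡ {xs = _ ∷ _} f g eq (there x∈) = map-≡⇒≡ f g (List.∷-injectiveʳ eq) x∈

  concatMap-map≡cartesianProductWith : (f : A → B → C) → ∀ xs ys →
    concatMap (λ x → map (f x) ys) xs ≡ cartesianProductWith f xs ys
  concatMap-map≡cartesianProductWith f []       ys = refl
  concatMap-map≡cartesianProductWith f (x ∷ xs) ys =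
    cong (map (f x) ys ++_) (concatMap-map≡cartesianProductWith f xs ys)

  unique∧set⇒↭ : Unique xs → Unique ys → (∀ {z} → z ∈ xs ⇔ z ∈ ys) → xs ↭ ys
  unique∧set⇒↭ xs! ys! xs⇔ys = ∼bag⇒↭ (unique∧set⇒bag xs! ys! xs⇔ys)

  count-≟-cong : (_≟_ : DecidableEquality B) {f g : A → B} → (∀ x → f x ≡ g x) → ∀ t xs →
    count (λ x → f x ≟ t) xs ≡ count (λ x → g x ≟ t) xs
  count-≟-cong _≟_ f≗g t =
    count-≐ _ _ ((λ {x} fx≡t → trans (sym (f≗g x)) fx≡t) , (λ {x} gx≡t → trans (f≗g x) gx≡t))

open Counting

module EtaTerms where

  open import Data.Nat using (_+_; _*_; _≟_; _≤?_)
  open import Data.Nat.Divisibility using (_∣?_; divides)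
  open import Data.Sum.Function.Propositional using (_⊎-⇔_)
  import Function.Properties.Equivalence as ⇔
  import Algebra.Properties.CommutativeSemigroup ℕ.*-commutativeSemigroup as *-CS

  private
    variable
      a : Level
      X : Set a

  -- Here q = p + 2, so the paper's q − 1 and q − 2 are suc p and p.

  count-*≡etaA : ∀ d .{{_ : NonZero d}} {A : ℕ → ℕ} (f : X → ℕ) xs → (∀ t → A t ≡ count (λ x → f x ≟ t) xs) →
    ∀ N → count (λ x → d * f x ≟ N) xs ≡ etaA A N d
  count-*≡etaA d f xs A≡ N with d ∣? N
  ... | yes (divides t N≡t*d) = trans (count-≐ _ _ ((λ {x} → to x) , (λ {x} → from x)) xs) (sym (A≡ t))
    where
    N≡d*t : N ≡ d * t
    N≡d*t = trans N≡t*d (ℕ.*-comm t d)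
    to : ∀ x → d * f x ≡ N → f x ≡ t
    to x e = ℕ.*-cancelˡ-≡ (f x) t d (trans e N≡d*t)
    from : ∀ x → f x ≡ t → d * f x ≡ N
    from x e = trans (cong (d *_) e) (sym N≡d*t)
  ... | no d∤N = count-none _ (λ x e → d∤N (divides (f x) (trans (sym e) (ℕ.*-comm d (f x))))) xs

  n+p*y≡i⇔p*y≡i∸n : ∀ {n i} → n ≤ i → ∀ p y → n + p * y ≡ i ⇔ p * y ≡ i ∸ n
  n+p*y≡i⇔p*y≡i∸n {n} {i} n≤i p y = mk⇔
    (λ e → trans (sym (ℕ.m+n∸m≡n n (p * y))) (cong (_∸ n) e))
    (λ e → trans (cong (n +_) e) (ℕ.m+[n∸m]≡n n≤i))

  count-affine≡secondTerm : ∀ p .{{_ : NonZero p}} n {A : ℕ → ℕ} (f g : X → ℕ) → (∀ x → g x ≡ suc p * f x) →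
    ∀ xs → (∀ t → A t ≡ count (λ x → g x ≟ t) xs) →
    ∀ i → count (λ x → n + p * f x ≟ i) xs ≡ secondTerm A (suc (suc p)) n i
  count-affine≡secondTerm p n f g g≡ xs A≡ i with n ≤? i
  ... | no n≰i = count-none _ (λ x e → n≰i (subst (n ≤_) e (ℕ.m≤m+n n _))) xs
  ... | yes n≤i = trans (count-≐ _ _ ((λ {x} → to x) , (λ {x} → from x)) xs) (count-*≡etaA p g xs A≡ ((i ∸ n) * suc p))
    where
    p*g≡p*f*s : ∀ x → p * g x ≡ p * f x * suc p
    p*g≡p*f*s x = trans (cong (p *_) (g≡ x)) (*-CS.x∙yz≈xz∙y p (suc p) (f x))
    to : ∀ x → n + p * f x ≡ i → p * g x ≡ (i ∸ n) * suc p
    to x e = trans (p*g≡p*f*s x) (cong (_* suc p) (Equivalence.to (n+p*y≡i⇔p*y≡i∸n n≤i p (f x)) e))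
    from : ∀ x → p * g x ≡ (i ∸ n) * suc p → n + p * f x ≡ i
    from x e = Equivalence.from (n+p*y≡i⇔p*y≡i∸n n≤i p (f x))
      (ℕ.*-cancelʳ-≡ (p * f x) (i ∸ n) (suc p) (trans (sym (p*g≡p*f*s x)) e))

  etaA≢0⇔ : (A : ℕ → ℕ) (N d : ℕ) .{{_ : NonZero d}} → etaA A N d ≢ 0 ⇔ ∃ λ t → N ≡ d * t × A t ≢ 0
  etaA≢0⇔ A N d with d ∣? N
  ... | yes (divides t N≡t*d) = mk⇔ (λ At≢0 → t , N≡d*t , At≢0) from
    where
    N≡d*t : N ≡ d * t
    N≡d*t = trans N≡t*d (ℕ.*-comm t d)
    from : (∃ λ t′ → N ≡ d * t′ × A t′ ≢ 0) → A t ≢ 0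
    from (t′ , N≡d*t′ , At′≢0) rewrite ℕ.*-cancelˡ-≡ t t′ d (trans (sym N≡d*t) N≡d*t′) = At′≢0
  ... | no d∤N = mk⇔ (λ 0≢0 → contradiction refl 0≢0)
                     (λ (t , N≡d*t , _) → contradiction (divides t (trans N≡d*t (ℕ.*-comm d t))) d∤N)

  secondTerm≢0⇔ : (A : ℕ → ℕ) (p : ℕ) .{{_ : NonZero p}} (n w : ℕ) →
    secondTerm A (suc (suc p)) n w ≢ 0 ⇔ ∃ λ t → w * suc p ≡ n * suc p + p * t × A t ≢ 0
  secondTerm≢0⇔ A p n w with n ≤? w
  ... | yes n≤w = ⇔.trans (etaA≢0⇔ A ((w ∸ n) * suc p) p) (mk⇔
        (λ (t , e , At≢0) → t , trans w*s≡ (cong (n * suc p +_) e) , At≢0)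
        (λ (t , e , At≢0) → t , ℕ.+-cancelˡ-≡ (n * suc p) _ _ (trans (sym w*s≡) e) , At≢0))
    where
    w*s≡ : w * suc p ≡ n * suc p + (w ∸ n) * suc p
    w*s≡ = trans (cong (_* suc p) (sym (ℕ.m+[n∸m]≡n n≤w))) (ℕ.*-distribʳ-+ (suc p) n (w ∸ n))
  ... | no n≰w = mk⇔ (λ 0≢0 → contradiction refl 0≢0)
                     (λ (t , e , _) → contradiction (ℕ.*-cancelʳ-≤ n w (suc p) (subst (n * suc p ≤_) (sym e) (ℕ.m≤m+n _ _)))
                                                    n≰w)

  +-*-≢0⇔ : ∀ x y s → x + suc s * y ≢ 0 ⇔ (x ≢ 0 ⊎ y ≢ 0)
  +-*-≢0⇔ x y s = mk⇔ to from
    where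
    to : x + suc s * y ≢ 0 → x ≢ 0 ⊎ y ≢ 0
    to sum≢0 with x ≟ 0 | y ≟ 0
    ... | yes refl | yes refl = contradiction (ℕ.*-zeroʳ (suc s)) sum≢0
    ... | no x≢0   | _        = inj₁ x≢0
    ... | _        | no y≢0   = inj₂ y≢0
    from : x ≢ 0 ⊎ y ≢ 0 → x + suc s * y ≢ 0
    from (inj₁ x≢0) sum≡0 = x≢0 (ℕ.m+n≡0⇒m≡0 x sum≡0)
    from (inj₂ y≢0) sum≡0 = y≢0 (ℕ.m*n≡0⇒m≡0 y (suc s) (trans (ℕ.*-comm y (suc s)) (ℕ.m+n≡0⇒n≡0 x sum≡0)))

  weightSpectrum : (A B : ℕ → ℕ) (p : ℕ) .{{_ : NonZero p}} (n : ℕ) → (∀ t → A t ≢ 0 → t ≤ n) →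
    (∀ i → B i ≡ etaA A i 2 + suc p * secondTerm A (suc (suc p)) n i) →
    ∀ w → B w ≢ 0 ⇔ ∃ λ i → i ≤ n × A i ≢ 0 × (w ≡ 2 * i ⊎ w * suc p ≡ n * suc p + p * i)
  weightSpectrum A B p n support B≡ w =
    subst (λ b → b ≢ 0 ⇔ _) (sym (B≡ w))
      (⇔.trans (+-*-≢0⇔ _ _ p) (⇔.trans (etaA≢0⇔ A w 2 ⊎-⇔ secondTerm≢0⇔ A p n w) merge))
    where
    merge : ∀ {P Q : ℕ → Set} → ((∃ λ t → P t × A t ≢ 0) ⊎ (∃ λ t → Q t × A t ≢ 0)) ⇔
                                 (∃ λ t → t ≤ n × A t ≢ 0 × (P t ⊎ Q t))
    merge = mk⇔ (λ { (inj₁ (t , Pt , At≢0)) → t , support t At≢0 , At≢0 , inj₁ Pt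
                   ; (inj₂ (t , Qt , At≢0)) → t , support t At≢0 , At≢0 , inj₂ Qt })
                (λ { (t , _ , At≢0 , inj₁ Pt) → inj₁ (t , Pt , At≢0)
                   ; (t , _ , At≢0 , inj₂ Qt) → inj₂ (t , Qt , At≢0) })

open EtaTerms

module LinearAlgebra {q : ℕ} (𝔽 : FiniteField q) where

  open FiniteField 𝔽
  open FF 𝔽

  commutativeRing : CommutativeRing 0ℓ 0ℓ
  commutativeRing = record { isCommutativeRing = isCommutativeRing }

  open CommutativeRing commutativeRing
    using ( +-identityˡ; +-identityʳ; *-identityˡ; *-identityʳ; zeroˡ; zeroʳ; distribˡ; distribʳ; -‿inverseˡ
          ; +-assoc; *-assoc; *-comm; +-group; +-commutativeSemigroup; *-commutativeSemigroup)
  open import Algebra.Properties.Group +-group using (⁻¹-injective; ε⁻¹≈ε)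
  open import Algebra.Properties.CommutativeSemigroup +-commutativeSemigroup using (interchange)
  open import Algebra.Properties.CommutativeSemigroup *-commutativeSemigroup using (x∙yz≈y∙xz)
  open ≡-Reasoning

  *-cancelˡ-≢0 : ∀ {c x y} → c ≢ 0# → c * x ≡ c * y → x ≡ y
  *-cancelˡ-≢0 {c} {x} {y} c≢0 cx≡cy with inverse c c≢0
  ... | d , cd≡1 = begin
    x             ≡⟨ sym (*-identityˡ x) ⟩
    1# * x        ≡⟨ cong (_* x) (trans (sym cd≡1) (*-comm c d)) ⟩
    (d * c) * x   ≡⟨ *-assoc d c x ⟩
    d * (c * x)   ≡⟨ cong (d *_) cx≡cy ⟩
    d * (c * y)   ≡⟨ sym (*-assoc d c y) ⟩
    (d * c) * y   ≡⟨ cong (_* y) (trans (*-comm d c) cd≡1) ⟩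
    1# * y        ≡⟨ *-identityˡ y ⟩
    y             ∎

  -≢0 : ∀ {b} → b ≢ 0# → - b ≢ 0#
  -≢0 b≢0 -b≡0 = b≢0 (⁻¹-injective (trans -b≡0 (sym ε⁻¹≈ε)))

  ·-zeroʳ : ∀ {m} (a : Vec F m) → a · 0v ≡ 0#
  ·-zeroʳ []       = refl
  ·-zeroʳ (a ∷ as) = trans (cong₂ _+_ (zeroʳ a) (·-zeroʳ as)) (+-identityˡ 0#)

  ·-zeroˡ : ∀ {m} (x : Vec F m) → 0v · x ≡ 0#
  ·-zeroˡ []       = refl
  ·-zeroˡ (x ∷ xs) = trans (cong₂ _+_ (zeroˡ x) (·-zeroˡ xs)) (+-identityˡ 0#)

  ·-scaleʳ : ∀ {m} (a x : Vec F m) c → a · scale c x ≡ c * (a · x)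
  ·-scaleʳ []       []       c = sym (zeroʳ c)
  ·-scaleʳ (a ∷ as) (x ∷ xs) c =
    trans (cong₂ _+_ (x∙yz≈y∙xz a c x) (·-scaleʳ as xs c)) (sym (distribˡ c (a * x) (as · xs)))

  ·-linearʳ : ∀ {m} (a y x : Vec F m) c → a · (scale c y +v x) ≡ c * (a · y) + a · x
  ·-linearʳ []       []       []       c = sym (trans (+-identityʳ _) (zeroʳ c))
  ·-linearʳ (a ∷ as) (y ∷ ys) (x ∷ xs) c = begin
    a * (c * y + x) + as · (scale c ys +v xs)              ≡⟨ cong₂ _+_ (distribˡ a (c * y) x) (·-linearʳ as ys xs c) ⟩
    (a * (c * y) + a * x) + (c * (as · ys) + as · xs)      ≡⟨ interchange _ _ _ _ ⟩
    (a * (c * y) + c * (as · ys)) + (a * x + as · xs)      ≡⟨ cong (_+ (a * x + as · xs)) (cong (_+ c * (as · ys)) (x∙yz≈y∙xz a c y)) ⟩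
    (c * (a * y) + c * (as · ys)) + (a * x + as · xs)      ≡⟨ cong (_+ (a * x + as · xs)) (distribˡ c (a * y) (as · ys)) ⟨
    c * (a * y + as · ys) + (a * x + as · xs)              ∎

  ·-∷ʳ : ∀ {m} (a x : Vec F m) b e → (a ∷ʳ b) · (x ∷ʳ e) ≡ a · x + b * e
  ·-∷ʳ []       []       b e = trans (+-identityʳ _) (sym (+-identityˡ _))
  ·-∷ʳ (a ∷ as) (x ∷ xs) b e = trans (cong (a * x +_) (·-∷ʳ as xs b e)) (sym (+-assoc _ _ _))

  ·-∷ʳ-0# : ∀ {m} (a x : Vec F m) b → (a ∷ʳ b) · (x ∷ʳ 0#) ≡ a · x
  ·-∷ʳ-0# a x b = trans (·-∷ʳ a x b 0#) (trans (cong (a · x +_) (zeroʳ b)) (+-identityʳ _))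

  ·-∷ʳ-1# : ∀ {m} (a x : Vec F m) b → (a ∷ʳ b) · (x ∷ʳ 1#) ≡ a · x + b
  ·-∷ʳ-1# a x b = trans (·-∷ʳ a x b 1#) (cong (a · x +_) (*-identityʳ b))

  scale-injective : ∀ {m c} → c ≢ 0# → {x y : Vec F m} → scale c x ≡ scale c y → x ≡ y
  scale-injective c≢0 {[]}     {[]}     _   = refl
  scale-injective c≢0 {x ∷ xs} {y ∷ ys} cx≡cy =
    cong₂ _∷_ (*-cancelˡ-≢0 c≢0 (Vec.∷-injectiveˡ cx≡cy)) (scale-injective c≢0 (Vec.∷-injectiveʳ cx≡cy))

  ·-injectiveˡ : ∀ {m} (a a′ : Vec F m) → (∀ x → a · x ≡ a′ · x) → a ≡ a′
  ·-injectiveˡ []       []         _     = refl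
  ·-injectiveˡ (a ∷ as) (a′ ∷ as′) a·≡a′· = cong₂ _∷_ head≡ (·-injectiveˡ as as′ tail·≡)
    where
    head≡ : a ≡ a′
    head≡ = begin
      a                    ≡⟨ sym (*-identityʳ a) ⟩
      a * 1#               ≡⟨ sym (trans (cong (a * 1# +_) (·-zeroʳ as)) (+-identityʳ _)) ⟩
      a * 1# + as · 0v     ≡⟨ a·≡a′· (1# ∷ 0v) ⟩
      a′ * 1# + as′ · 0v   ≡⟨ trans (cong (a′ * 1# +_) (·-zeroʳ as′)) (+-identityʳ _) ⟩
      a′ * 1#              ≡⟨ *-identityʳ a′ ⟩
      a′                   ∎
    tail·≡ : ∀ y → as · y ≡ as′ · y
    tail·≡ y = begin
      as · y               ≡⟨ sym (trans (cong (_+ as · y) (zeroʳ a)) (+-identityˡ _)) ⟩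
      a * 0# + as · y      ≡⟨ a·≡a′· (0# ∷ y) ⟩
      a′ * 0# + as′ · y    ≡⟨ trans (cong (_+ as′ · y) (zeroʳ a′)) (+-identityˡ _) ⟩
      as′ · y              ∎

  Span-mono : ∀ {m} {S T : Vec F m → Set} → (∀ {y} → S y → T y) → ∀ {x} → Span S x → Span T x
  Span-mono S⊆T span-0                 = span-0
  Span-mono S⊆T (span-+ c y x Sy Span-x) = span-+ c y x (S⊆T Sy) (Span-mono S⊆T Span-x)

  ·-cong-Span : ∀ {m} {S : Vec F m → Set} (a a′ : Vec F m) → (∀ {y} → S y → a · y ≡ a′ · y) →
                ∀ {x} → Span S x → a · x ≡ a′ · x
  ·-cong-Span a a′ eq span-0 = trans (·-zeroʳ a) (sym (·-zeroʳ a′))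
  ·-cong-Span a a′ eq (span-+ c y x Sy Span-x) = begin
    a · (scale c y +v x)     ≡⟨ ·-linearʳ a y x c ⟩
    c * (a · y) + a · x      ≡⟨ cong₂ (λ u v → c * u + v) (eq Sy) (·-cong-Span a a′ eq Span-x) ⟩
    c * (a′ · y) + a′ · x    ≡⟨ ·-linearʳ a′ y x c ⟨
    a′ · (scale c y +v x)    ∎

  Span-≢0v⇒∃ : ∀ {m} {S : Vec F m → Set} {x} → Span S x → x ≢ 0v → ∃ S
  Span-≢0v⇒∃ span-0               x≢0 = ⊥-elim (x≢0 refl)
  Span-≢0v⇒∃ (span-+ _ y _ Sy _)  _   = y , Sy

  ∈-hyperplane : ∀ {k} (x : Vec F (suc (suc k))) → ∃ λ u → u ≢ 0v × Hyperplane u x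
  ∈-hyperplane (x₀ ∷ x₁ ∷ xs) with x₀ ≟ 0#
  ... | yes refl = 1# ∷ 0v , (λ u≡0 → 0≢1 (sym (Vec.∷-injectiveˡ u≡0))) ,
                   trans (cong₂ _+_ (zeroʳ 1#) (·-zeroˡ (x₁ ∷ xs))) (+-identityˡ 0#)
  ... | no x₀≢0 = - x₁ ∷ x₀ ∷ 0v , (λ u≡0 → x₀≢0 (Vec.∷-injectiveˡ (Vec.∷-injectiveʳ u≡0))) , u·x≡0
    where
    u·x≡0 : - x₁ * x₀ + (x₀ * x₁ + 0v · xs) ≡ 0#
    u·x≡0 = begin
      - x₁ * x₀ + (x₀ * x₁ + 0v · xs)   ≡⟨ cong (λ z → - x₁ * x₀ + (x₀ * x₁ + z)) (·-zeroˡ xs) ⟩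
      - x₁ * x₀ + (x₀ * x₁ + 0#)        ≡⟨ cong (- x₁ * x₀ +_) (trans (+-identityʳ _) (*-comm x₀ x₁)) ⟩
      - x₁ * x₀ + x₁ * x₀               ≡⟨ distribʳ x₀ (- x₁) x₁ ⟨
      (- x₁ + x₁) * x₀                  ≡⟨ cong (_* x₀) (-‿inverseˡ x₁) ⟩
      0# * x₀                           ≡⟨ zeroˡ x₀ ⟩
      0#                                ∎

  Spanning : ∀ {m} → List (Vec F m) → Set
  Spanning D = ∀ x → Span (_∈ D) x

  cutting⇒spanning : ∀ {k} (D : List (Vec F (suc (suc k)))) → VectorialCutting D → Spanning D
  cutting⇒spanning D cutting x =
    let u , u≢0 , x∈H = ∈-hyperplane x
    in Span-mono (λ (y∈D , _) → y∈D) (Equivalence.from (cutting u u≢0 x) x∈H)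

  spanning⇒nonempty : ∀ {k} {D : List (Vec F (suc k))} → Spanning D → ∃ (_∈ D)
  spanning⇒nonempty spanning = Span-≢0v⇒∃ (spanning (1# ∷ 0v)) (λ e → 0≢1 (sym (Vec.∷-injectiveˡ e)))

  spanning⇒·-injective : ∀ {m} {D : List (Vec F m)} → Spanning D →
    ∀ {a a′} → (∀ {y} → y ∈ D → a · y ≡ a′ · y) → a ≡ a′
  spanning⇒·-injective spanning {a} {a′} agree = ·-injectiveˡ a a′ (λ x → ·-cong-Span a a′ agree (spanning x))

  codeword-injective : ∀ {m} {D : List (Vec F m)} → Spanning D → ∀ {a a′} → codeword D a ≡ codeword D a′ → a ≡ a′
  codeword-injective spanning {a} {a′} eq = spanning⇒·-injective spanning (map-≡⇒≡ (a ·_) (a′ ·_) eq)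

  allVecs-unique : ∀ m → Unique (allVecs m)
  allVecs-unique zero    = [] ∷ []
  allVecs-unique (suc m) = subst Unique (sym (concatMap-map≡cartesianProductWith _∷_ elements (allVecs m)))
    (Unique.cartesianProductWith⁺ _∷_ Vec.∷-injective unique (allVecs-unique m))

  allVecs-complete : ∀ m (x : Vec F m) → x ∈ allVecs m
  allVecs-complete zero    []       = here refl
  allVecs-complete (suc m) (x ∷ xs) = subst (x ∷ xs ∈_) (sym (concatMap-map≡cartesianProductWith _∷_ elements (allVecs m)))
    (∈-cartesianProductWith⁺ _∷_ (complete x) (allVecs-complete m xs))

  allVecs∷ʳ : ∀ m → List (Vec F (suc m))
  allVecs∷ʳ m = cartesianProductWith (λ b a → a ∷ʳ b) elements (allVecs m)

  allVecs∷ʳ-unique : ∀ m → Unique (allVecs∷ʳ m)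
  allVecs∷ʳ-unique m = Unique.cartesianProductWith⁺ _ (λ eq → swap (Vec.∷ʳ-injective _ _ eq)) unique (allVecs-unique m)

  allVecs∷ʳ-complete : ∀ m (w : Vec F (suc m)) → w ∈ allVecs∷ʳ m
  allVecs∷ʳ-complete m w with initLast w
  ... | a , b , refl = ∈-cartesianProductWith⁺ (λ b a → a ∷ʳ b) (complete b) (allVecs-complete m a)

  numWeight≡count : ∀ {m} (D : List (Vec F m)) {L : List (Vec F m)} → Unique L → (∀ a → a ∈ L) →
    (∀ {a a′} → codeword D a ≡ codeword D a′ → a ≡ a′) →
    ∀ t → numWeight D t ≡ count (λ a → weight (codeword D a) ℕ.≟ t) L
  numWeight≡count {m} D {L} L! L-complete injective t =
    trans (count-↭ _ code↭L) (count-map (λ c → weight c ℕ.≟ t) (codeword D) L)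
    where
    ≟-list : DecidableEquality (List F)
    ≟-list = List.≡-dec _≟_
    code↭L : code D ↭ map (codeword D) L
    code↭L = unique∧set⇒↭ (deduplicate-! ≟-list _) (Unique.map⁺ injective L!) (mk⇔
      (λ c∈ → let a , _ , c≡ = ∈-map⁻ (codeword D) (Equivalence.from (deduplicate-∈⇔ ≟-list) c∈)
              in subst (_∈ map (codeword D) L) (sym c≡) (∈-map⁺ (codeword D) (L-complete a)))
      (λ c∈ → let a , _ , c≡ = ∈-map⁻ (codeword D) c∈
              in Equivalence.to (deduplicate-∈⇔ ≟-list)
                   (subst (_∈ map (codeword D) (allVecs m)) (sym c≡) (∈-map⁺ (codeword D) (allVecs-complete m a)))))

  numWeight≢0⇒≤length : ∀ {m} (D : List (Vec F m)) t → numWeight D t ≢ 0 → t ≤ length D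
  numWeight≢0⇒≤length {m} D t A≢0 =
    let c , c∈ , weight≡t = count≢0⇒∃ _ (code D) A≢0
        a , _ , c≡ = ∈-map⁻ (codeword D) (Equivalence.from (deduplicate-∈⇔ (List.≡-dec _≟_)) c∈)
    in subst₂ _≤_ weight≡t (trans (cong length c≡) (List.length-map (a ·_) D)) (List.length-filter _ c)

  ∑-field : {h : F → ℕ} {μ : ℕ} → (∀ c → c ≢ 0# → h c ≡ μ) → ∑ elements h ≡ h 0# ℕ.+ (q ∸ 1) ℕ.* μ
  ∑-field {h} {μ} h≡μ = trans (∑-const-except unique (complete 0#) h≡μ) (cong (λ l → h 0# ℕ.+ (l ∸ 1) ℕ.* μ) card)

module Fibres {q : ℕ} (𝔽 : FiniteField q) {m : ℕ} (D : List (Vec (FiniteField.F 𝔽) m)) (D! : Unique D)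
  (scale-closed : ∀ c → c ≢ FiniteField.0# 𝔽 → ∀ x → x ∈ D → FF.scale 𝔽 c x ∈ D)
  (scale-onto : ∀ c → c ≢ FiniteField.0# 𝔽 → ∀ y → y ∈ D → ∃ λ x → x ∈ D × FF.scale 𝔽 c x ≡ y) where

  open FiniteField 𝔽
  open FF 𝔽
  open LinearAlgebra 𝔽
  open CommutativeRing commutativeRing using (*-identityʳ)
  open ≡-Reasoning

  wt : Vec F m → ℕ
  wt a = weight (codeword D a)

  fibre : Vec F m → F → ℕ
  fibre a c = count (λ x → (a · x) ≟ c) D

  D↭scale-D : ∀ {c} → c ≢ 0# → D ↭ map (scale c) D
  D↭scale-D {c} c≢0 = unique∧set⇒↭ D! (Unique.map⁺ (scale-injective c≢0) D!) (mk⇔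
    (λ y∈D → let x , x∈D , cx≡y = scale-onto c c≢0 _ y∈D in subst (_∈ map (scale c) D) cx≡y (∈-map⁺ (scale c) x∈D))
    (λ y∈cD → let x , x∈D , y≡cx = ∈-map⁻ (scale c) y∈cD in subst (_∈ D) (sym y≡cx) (scale-closed c c≢0 x x∈D)))

  fibre-scale : ∀ a {c} → c ≢ 0# → fibre a c ≡ fibre a 1#
  fibre-scale a {c} c≢0 = begin
    count (λ x → (a · x) ≟ c) D                 ≡⟨ count-↭ _ (D↭scale-D c≢0) ⟩
    count (λ x → (a · x) ≟ c) (map (scale c) D)  ≡⟨ count-map _ (scale c) D ⟩
    count (λ x → (a · scale c x) ≟ c) D          ≡⟨ count-≐ _ _ ((λ {x} → to x) , (λ {x} → from x)) D ⟩
    count (λ x → (a · x) ≟ 1#) D                 ∎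
    where
    to : ∀ x → a · scale c x ≡ c → a · x ≡ 1#
    to x e = *-cancelˡ-≢0 c≢0 (trans (sym (·-scaleʳ a x c)) (trans e (sym (*-identityʳ c))))
    from : ∀ x → a · x ≡ 1# → a · scale c x ≡ c
    from x e = trans (·-scaleʳ a x c) (trans (cong (c *_) e) (*-identityʳ c))

  wt≡count : ∀ a → wt a ≡ count (λ x → ¬? ((a · x) ≟ 0#)) D
  wt≡count a = count-map (λ y → ¬? (y ≟ 0#)) (a ·_) D

  fibre0+wt≡length : ∀ a → fibre a 0# ℕ.+ wt a ≡ length D
  fibre0+wt≡length a = trans (cong (fibre a 0# ℕ.+_) (wt≡count a)) (count-+-count-∁ _ D)

  wt≡[q∸1]*fibre : ∀ a → wt a ≡ (q ∸ 1) ℕ.* fibre a 1#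
  wt≡[q∸1]*fibre a = ℕ.+-cancelˡ-≡ (fibre a 0#) _ _ (begin
    fibre a 0# ℕ.+ wt a      ≡⟨ fibre0+wt≡length a ⟩
    length D                                  ≡⟨ ∑-count-fibres _≟_ unique complete (a ·_) D ⟨
    ∑ elements (fibre a)                      ≡⟨ ∑-field (λ c c≢0 → fibre-scale a c≢0) ⟩
    fibre a 0# ℕ.+ (q ∸ 1) ℕ.* fibre a 1#     ∎)

module Doubling {p : ℕ} (𝔽 : FiniteField (suc (suc p))) {k : ℕ} (D : List (Vec (FiniteField.F 𝔽) (suc k))) (D! : Unique D)
  (scale-closed : ∀ c → c ≢ FiniteField.0# 𝔽 → ∀ x → x ∈ D → FF.scale 𝔽 c x ∈ D)
  (scale-onto : ∀ c → c ≢ FiniteField.0# 𝔽 → ∀ y → y ∈ D → ∃ λ x → x ∈ D × FF.scale 𝔽 c x ≡ y)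
  (spanning : LinearAlgebra.Spanning 𝔽 D) where

  open FiniteField 𝔽
  open FF 𝔽
  open LinearAlgebra 𝔽
  open Fibres 𝔽 D D! scale-closed scale-onto
  open CommutativeRing commutativeRing using (+-identityʳ; -‿inverseˡ; +-group)
  open import Algebra.Properties.Group +-group using (∙-cancelˡ; inverseˡ-unique)
  open ≡-Reasoning

  n : ℕ
  n = length D

  wt+ : Vec F (suc k) → F → ℕ
  wt+ a b = weight (map (λ x → a · x + b) D)

  codeword-doubleD : ∀ a b → codeword (doubleD D) (a ∷ʳ b) ≡ map (λ x → a · x + b) D ++ codeword D a
  codeword-doubleD a b = trans (List.map-++ ((a ∷ʳ b) ·_) (map (_∷ʳ 1#) D) _) (cong₂ _++_
    (trans (sym (List.map-∘ D)) (List.map-cong (λ x → ·-∷ʳ-1# a x b) D))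
    (trans (sym (List.map-∘ D)) (List.map-cong (λ x → ·-∷ʳ-0# a x b) D)))

  weight-doubleD : ∀ a b → weight (codeword (doubleD D) (a ∷ʳ b)) ≡ wt+ a b ℕ.+ wt a
  weight-doubleD a b = trans (cong weight (codeword-doubleD a b)) (count-++ _ (map (λ x → a · x + b) D) _)

  weight-doubleD-0# : ∀ a → weight (codeword (doubleD D) (a ∷ʳ 0#)) ≡ 2 ℕ.* wt a
  weight-doubleD-0# a = begin
    weight (codeword (doubleD D) (a ∷ʳ 0#))  ≡⟨ weight-doubleD a 0# ⟩
    wt+ a 0# ℕ.+ wt a                        ≡⟨ cong (λ c → weight c ℕ.+ wt a) (List.map-cong (λ x → +-identityʳ (a · x)) D) ⟩
    wt a ℕ.+ wt a                            ≡⟨ cong (wt a ℕ.+_) (ℕ.+-identityʳ (wt a)) ⟨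
    2 ℕ.* wt a                               ∎

  -- a · x + b vanishes exactly on the fibre over - b, which has as many points as the fibre over 1
  wt+-+fibre≡length : ∀ a {b} → b ≢ 0# → wt+ a b ℕ.+ fibre a 1# ≡ n
  wt+-+fibre≡length a {b} b≢0 = begin
    wt+ a b ℕ.+ fibre a 1#                                                       ≡⟨ ℕ.+-comm (wt+ a b) (fibre a 1#) ⟩
    fibre a 1# ℕ.+ wt+ a b                                                       ≡⟨ cong₂ ℕ._+_ zeros≡fibre (count-map _ (λ x → a · x + b) D) ⟩
    count (λ x → (a · x + b) ≟ 0#) D ℕ.+ count (λ x → ¬? ((a · x + b) ≟ 0#)) D  ≡⟨ count-+-count-∁ _ D ⟩
    n                                                                            ∎
    where
    zeros≡fibre : fibre a 1# ≡ count (λ x → (a · x + b) ≟ 0#) D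
    zeros≡fibre = trans (sym (fibre-scale a (-≢0 b≢0))) (count-≐ _ _
      ((λ {x} ax≡-b → trans (cong (_+ b) ax≡-b) (-‿inverseˡ b)) , (λ {x} → inverseˡ-unique (a · x) b)) D)

  weight-doubleD-≢0# : ∀ a {b} → b ≢ 0# → weight (codeword (doubleD D) (a ∷ʳ b)) ≡ n ℕ.+ p ℕ.* fibre a 1#
  weight-doubleD-≢0# a {b} b≢0 = begin
    weight (codeword (doubleD D) (a ∷ʳ b))              ≡⟨ weight-doubleD a b ⟩
    wt+ a b ℕ.+ wt a                                    ≡⟨ cong (wt+ a b ℕ.+_) (wt≡[q∸1]*fibre a) ⟩
    wt+ a b ℕ.+ (fibre a 1# ℕ.+ p ℕ.* fibre a 1#)       ≡⟨ ℕ.+-assoc (wt+ a b) (fibre a 1#) (p ℕ.* fibre a 1#) ⟨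
    wt+ a b ℕ.+ fibre a 1# ℕ.+ p ℕ.* fibre a 1#         ≡⟨ cong (ℕ._+ p ℕ.* fibre a 1#) (wt+-+fibre≡length a b≢0) ⟩
    n ℕ.+ p ℕ.* fibre a 1#                              ∎

  codeword-doubleD-injective : ∀ {w w′} → codeword (doubleD D) w ≡ codeword (doubleD D) w′ → w ≡ w′
  codeword-doubleD-injective {w} {w′} eq with initLast w | initLast w′
  ... | a , b , refl | a′ , b′ , refl = cong₂ _∷ʳ_ a≡a′ b≡b′
    where
    agree : ∀ {y} → y ∈ doubleD D → (a ∷ʳ b) · y ≡ (a′ ∷ʳ b′) · y
    agree = map-≡⇒≡ _ _ eq
    a≡a′ : a ≡ a′
    a≡a′ = spanning⇒·-injective spanning λ {x} x∈D → begin
      a · x                   ≡⟨ ·-∷ʳ-0# a x b ⟨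
      (a ∷ʳ b) · (x ∷ʳ 0#)    ≡⟨ agree (∈-++⁺ʳ (map (_∷ʳ 1#) D) (∈-map⁺ (_∷ʳ 0#) x∈D)) ⟩
      (a′ ∷ʳ b′) · (x ∷ʳ 0#)  ≡⟨ ·-∷ʳ-0# a′ x b′ ⟩
      a′ · x                  ∎
    b≡b′ : b ≡ b′
    b≡b′ = let x , x∈D = spanning⇒nonempty spanning in ∙-cancelˡ (a · x) b b′ (begin
      a · x + b               ≡⟨ ·-∷ʳ-1# a x b ⟨
      (a ∷ʳ b) · (x ∷ʳ 1#)    ≡⟨ agree (∈-++⁺ˡ (∈-map⁺ (_∷ʳ 1#) x∈D)) ⟩
      (a′ ∷ʳ b′) · (x ∷ʳ 1#)  ≡⟨ ·-∷ʳ-1# a′ x b′ ⟩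
      a′ · x + b′             ≡⟨ cong (λ a″ → a″ · x + b′) a≡a′ ⟨
      a · x + b′              ∎)

  Fᵏ : List (Vec F (suc k))
  Fᵏ = allVecs (suc k)

  Fᵏ⁺¹ : List (Vec F (suc (suc k)))
  Fᵏ⁺¹ = allVecs∷ʳ (suc k)

  numWeight-D : ∀ t → numWeight D t ≡ count (λ a → wt a ℕ.≟ t) Fᵏ
  numWeight-D = numWeight≡count D (allVecs-unique _) (allVecs-complete _) (codeword-injective spanning)

  numWeight-doubleD : ∀ i → numWeight (doubleD D) i ≡
    count (λ a → 2 ℕ.* wt a ℕ.≟ i) Fᵏ ℕ.+ suc p ℕ.* count (λ a → n ℕ.+ p ℕ.* fibre a 1# ℕ.≟ i) Fᵏ
  numWeight-doubleD i = begin
    numWeight (doubleD D) i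
      ≡⟨ numWeight≡count (doubleD D) (allVecs∷ʳ-unique _) (allVecs∷ʳ-complete _) codeword-doubleD-injective i ⟩
    count (λ w → weight (codeword (doubleD D) w) ℕ.≟ i) Fᵏ⁺¹
      ≡⟨ count-cartesianProductWith (λ w → weight (codeword (doubleD D) w) ℕ.≟ i) _ elements Fᵏ ⟩
    ∑[ b ∈ elements ] count (λ a → weight (codeword (doubleD D) (a ∷ʳ b)) ℕ.≟ i) Fᵏ
      ≡⟨ ∑-field (λ b b≢0 → count-≟-cong ℕ._≟_ (λ a → weight-doubleD-≢0# a b≢0) i Fᵏ) ⟩
    count (λ a → weight (codeword (doubleD D) (a ∷ʳ 0#)) ℕ.≟ i) Fᵏ ℕ.+ suc p ℕ.* affine
      ≡⟨ cong (ℕ._+ suc p ℕ.* affine) (count-≟-cong ℕ._≟_ weight-doubleD-0# i Fᵏ) ⟩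
    count (λ a → 2 ℕ.* wt a ℕ.≟ i) Fᵏ ℕ.+ suc p ℕ.* affine
      ∎
    where
    affine : ℕ
    affine = count (λ a → n ℕ.+ p ℕ.* fibre a 1# ℕ.≟ i) Fᵏ

  weightDistribution : .{{_ : NonZero p}} → ∀ i →
    numWeight (doubleD D) i ≡ etaA (numWeight D) i 2 ℕ.+ suc p ℕ.* secondTerm (numWeight D) (suc (suc p)) n i
  weightDistribution i = trans (numWeight-doubleD i) (cong₂ ℕ._+_
    (count-*≡etaA 2 wt Fᵏ numWeight-D i)
    (cong (suc p ℕ.*_) (count-affine≡secondTerm p n (λ a → fibre a 1#) _ wt≡[q∸1]*fibre Fᵏ numWeight-D i)))

open import Data.Nat using (_+_; _*_)

corollary14 :
    (q : ℕ) → 3 ≤ q → IsPrimePower q → (𝔽 : FiniteField q) →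
    (k : ℕ) → 2 ≤ k →
    (D : List (Vec (FiniteField.F 𝔽) k)) → Unique D →
    (∀ x → x ∈ D → x ≢ FF.0v 𝔽) →
    FF.VectorialCutting 𝔽 D →
    (∀ (a : FiniteField.F 𝔽) → a ≢ FiniteField.0# 𝔽 → ∀ x → x ∈ D → FF.scale 𝔽 a x ∈ D) →
    (∀ (a : FiniteField.F 𝔽) → a ≢ FiniteField.0# 𝔽 → ∀ y → y ∈ D → Σ (Vec (FiniteField.F 𝔽) k) λ x → x ∈ D × FF.scale 𝔽 a x ≡ y) →
    let n = length D
        A = FF.numWeight 𝔽 D
        B = FF.numWeight 𝔽 (FF.doubleD 𝔽 D)
    in (∀ (w : ℕ) → w ≢ 0 →
          (B w ≢ 0 ⇔ Σ ℕ λ i → i ≤ n × A i ≢ 0 × (w ≡ 2 * i ⊎ w * (q ∸ 1) ≡ n * (q ∸ 1) + (q ∸ 2) * i)))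
       × (∀ (i : ℕ) → B i ≡ etaA A i 2 + (q ∸ 1) * secondTerm A q n i)
corollary14 (suc (suc (suc r))) (s≤s (s≤s (s≤s _))) _ 𝔽 (suc (suc k)) (s≤s (s≤s _)) D D! _ cutting scale-closed scale-onto =
  (λ w _ → weightSpectrum (numWeight D) (numWeight (doubleD D)) (suc r) n (numWeight≢0⇒≤length D) weightDistribution w) ,
  weightDistribution
  where
  open FF 𝔽
  open LinearAlgebra 𝔽
  open Doubling 𝔽 D D! scale-closed scale-onto (cutting⇒spanning D cutting)
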